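{- For the wheel graph $W_{1,r}=K_1+C_r$ with $r\ge 4$, $pd_s(W_{1,r})=3$ if $r=4$, and $pd_s(W_{1,r})=\lceil r/2\rceil$ if $r\ge 5$.
   Context: Graphs are finite, simple, connected; $d_G$ is shortest-path distance, $d_G(x,W)=\min\{d_G(x,w):w\in W\}$. A set $W$ strongly resolves different vertices $x,y\notin W$ if $d_G(x,W)=d_G(x,y)+d_G(y,W)$ or $d_G(y,W)=d_G(y,x)+d_G(x,W)$. A vertex partition $\Pi$ is a strong resolving partition if every two different vertices in the same set of $\Pi$ are strongly resolved by some set of $\Pi$; $pd_s(G)$ is the minimum cardinality of such a partition. $K_1+C_r$ is the graph obtained from a cycle $C_r$ and one additional vertex adjacent to all vertices of the cycle. -}

module Defs where

open import Data.Nat using (ℕ; zero; suc; _+_; _≤_; _∸_)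
open import Data.Fin using (Fin; zero; suc; toℕ)
open import Data.Product using (Σ; _×_; _,_; ∃)
open import Data.Sum using (_⊎_)
open import Data.Unit using (⊤)
open import Data.Empty using (⊥)
open import Relation.Binary.PropositionalEquality using (_≡_; _≢_)
open import Relation.Nullary using (¬_)

record Graph : Set₁ where
  field
    n   : ℕ
    Adj : Fin n → Fin n → Set
open Graph public

data Walk (G : Graph) : Fin (n G) → Fin (n G) → ℕ → Set where
  here : ∀ {x} → Walk G x x 0
  step : ∀ {x y z k} → Adj G x y → Walk G y z k → Walk G x z (suc k)

Dist : (G : Graph) → Fin (n G) → Fin (n G) → ℕ → Set
Dist G x y k = Walk G x y k × (∀ j → Walk G x y j → k ≤ j)

DistSet : (G : Graph) → Fin (n G) → (Fin (n G) → Set) → ℕ → Set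
DistSet G x W k =
  (Σ (Fin (n G)) λ w → W w × Dist G x w k) ×
  (∀ w j → W w → Dist G x w j → k ≤ j)

StronglyResolves : (G : Graph) → (Fin (n G) → Set) → Fin (n G) → Fin (n G) → Set
StronglyResolves G W x y =
  ¬ W x × ¬ W y ×
  ((∃ λ a → ∃ λ b → ∃ λ c →
      DistSet G x W a × Dist G x y b × DistSet G y W c × a ≡ b + c)
   ⊎
   (∃ λ a → ∃ λ b → ∃ λ c →
      DistSet G y W a × Dist G y x b × DistSet G x W c × a ≡ b + c))

-- A partition of V(G) into k (nonempty) classes, given by a class map f.
IsPartition : (G : Graph) (k : ℕ) → (Fin (n G) → Fin k) → Set
IsPartition G k f = ∀ (i : Fin k) → Σ (Fin (n G)) λ v → f v ≡ i

Class : (G : Graph) {k : ℕ} → (Fin (n G) → Fin k) → Fin k → Fin (n G) → Set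
Class G f i v = f v ≡ i

IsStrongResolvingPartition : (G : Graph) (k : ℕ) → (Fin (n G) → Fin k) → Set
IsStrongResolvingPartition G k f =
  IsPartition G k f ×
  (∀ x y → x ≢ y → f x ≡ f y →
     Σ (Fin k) λ i → StronglyResolves G (Class G f i) x y)

PDs : Graph → ℕ → Set
PDs G m =
  (Σ (Fin (n G) → Fin m) λ f → IsStrongResolvingPartition G m f) ×
  (∀ k (f : Fin (n G) → Fin k) → IsStrongResolvingPartition G k f → m ≤ k)

CycSucc : (r : ℕ) → Fin r → Fin r → Set
CycSucc r i j = (suc (toℕ i) ≡ toℕ j) ⊎ ((toℕ i ≡ r ∸ 1) × (toℕ j ≡ 0))

CycAdj : (r : ℕ) → Fin r → Fin r → Set
CycAdj r i j = CycSucc r i j ⊎ CycSucc r j i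

-- Wheel W_{1,r} = K_1 + C_r on Fin (suc r): vertex zero is the hub,
-- vertex suc i is the i-th cycle vertex.
WheelAdj : (r : ℕ) → Fin (suc r) → Fin (suc r) → Set
WheelAdj r zero    zero    = ⊥
WheelAdj r zero    (suc _) = ⊤
WheelAdj r (suc _) zero    = ⊤
WheelAdj r (suc i) (suc j) = CycAdj r i j

Wheel : ℕ → Graph
Wheel r = record { n = suc r ; Adj = WheelAdj r }

-- Everything rests on the wheel having diameter 2 (module WheelGeometry).  If W strongly
-- resolves distinct x, y ∉ W, say d(x,W) = d(x,y) + d(y,W), both summands are at least 1
-- while d(x,W) ≤ 2, so x ~ y; and the hub is not in W, since otherwise d(x,W) ≤ 1
-- (resolved⇒edge).  Conversely resolvedBy: if x has no neighbour in W but its neighbour y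
-- has one, then W strongly resolves x and y.
-- Lower bounds: each class of a strong resolving partition is a clique, so, C_r being
-- triangle-free, it holds at most two rim vertices and these are consecutive; this yields
-- an injection of the rim into two copies of the set of classes, hence r ≤ 2k
-- (RimLowerBound).  Two classes are never enough (NoTwoClasses), which settles r = 4.
-- Upper bounds: the explicit partitions {hub,0,1}, {2}, {3} for r = 4 (FourWheel) and
-- {hub,0,1}, {2,3}, {4,5}, … for r ≥ 5 (BlockPartition), each pair inside a class being
-- resolved by resolvedBy through a suitable neighbouring class.
module Submission where

open import Defs
open import Data.Nat using (ℕ; _≤_; ⌈_/2⌉)
open import Data.Product using (_×_)
open import Relation.Binary.PropositionalEquality using (_≡_)

open import Data.Nat using (zero; suc; _+_; _∸_; _<_; z≤n; s≤s; ⌊_/2⌋)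
open import Data.Nat.Properties
  using (≤-trans; ≤-refl; ≤-reflexive; m≤m+n; n≤1+n; 1+n≰n; n≮0; ≰⇒>; 0≢1+n; 1+n≢n;
         suc-injective; +-suc; ⌈n/2⌉-mono; n≡⌊n+n/2⌋; n≡⌈n+n/2⌉)
open import Data.Fin using (Fin; zero; suc; toℕ; #_; fromℕ; fromℕ<; inject₁; join; splitAt)
  renaming (_≟_ to _≟ᶠ_)
open import Data.Fin.Properties
  using (toℕ-injective; toℕ-fromℕ; toℕ-fromℕ<; toℕ-inject₁; toℕ<n; injective⇒≤; splitAt-join)
  renaming (suc-injective to rim-injective)
open import Data.Product using (Σ; ∃; _,_; proj₁; proj₂; map₂)
open import Data.Sum using (_⊎_; inj₁; inj₂; swap; [_,_]) renaming (map₂ to ⊎-map₂)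
open import Data.Sum.Properties using (inj₁-injective; inj₂-injective)
open import Data.Unit using (tt)
open import Data.Empty using (⊥; ⊥-elim)
open import Function using (_∘_)
open import Relation.Nullary using (¬_; yes; no)
open import Relation.Binary.PropositionalEquality
  using (_≢_; refl; sym; trans; cong; subst; module ≡-Reasoning)

pattern hub   = zero
pattern rim i = suc i

module WheelGeometry (r : ℕ) where

  V : Set
  V = Fin (suc r)

  _~_ : V → V → Set
  x ~ y = WheelAdj r x y

  walk₀ : ∀ {x y} → Walk (Wheel r) x y 0 → x ≡ y
  walk₀ here = refl

  walk₁ : ∀ {x y} → Walk (Wheel r) x y 1 → x ~ y
  walk₁ (step e here) = e

  toHub : ∀ x → x ≢ hub → x ~ hub
  toHub hub   x≢hub = ⊥-elim (x≢hub refl)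
  toHub (rim _) _   = tt

  shortWalk : ∀ x y → ∃ λ j → j ≤ 2 × Walk (Wheel r) x y j
  shortWalk hub     hub     = 0 , z≤n , here
  shortWalk hub     (rim _) = 1 , s≤s z≤n , step tt here
  shortWalk (rim _) hub     = 1 , s≤s z≤n , step tt here
  shortWalk (rim _) (rim _) = 2 , ≤-refl , step {y = hub} tt (step tt here)

  dist≤2 : ∀ {x y a} → Dist (Wheel r) x y a → a ≤ 2
  dist≤2 {x} {y} (_ , least) with shortWalk x y
  ... | j , j≤2 , walk = ≤-trans (least j walk) j≤2

  edgeDist : ∀ {x y} → x ≢ y → x ~ y → Dist (Wheel r) x y 1
  edgeDist x≢y x~y = step x~y here , λ
    { zero    walk → ⊥-elim (x≢y (walk₀ walk))
    ; (suc _) _    → s≤s z≤n }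

  -- d(x,W) = d(x,y) + d(y,W) for distinct x, y ∉ W forces x ~ y and hub ∉ W:
  -- both summands are at least 1 while d(x,W) ≤ 2, and hub ∈ W would give d(x,W) ≤ 1.
  forcedEdge : ∀ {W : V → Set} {x y a b c} → x ≢ y → ¬ W x → ¬ W y →
    DistSet (Wheel r) x W a → Dist (Wheel r) x y b → DistSet (Wheel r) y W c →
    a ≡ b + c → x ~ y × ¬ W hub
  forcedEdge {b = zero} x≢y _ _ _ dxy _ _ = ⊥-elim (x≢y (walk₀ (proj₁ dxy)))
  forcedEdge {W} {b = suc _} {c = zero} _ _ y∉W _ _ ((w , w∈W , dyw) , _) _ =
    ⊥-elim (y∉W (subst W (sym (walk₀ (proj₁ dyw))) w∈W))
  forcedEdge {b = suc (suc b)} {c = suc c} _ _ _ ((_ , _ , dxw) , _) _ _ refl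
    with dist≤2 dxw
  ... | s≤s (s≤s b+c+1≤0) = ⊥-elim (n≮0 (subst (_≤ 0) (+-suc b c) b+c+1≤0))
  forcedEdge {W} {x} {b = suc zero} {c = suc _} _ x∉W _ (_ , least) dxy _ refl =
    walk₁ (proj₁ dxy) , hub∉W
    where
      x≢hub : W hub → x ≢ hub
      x≢hub hub∈W x≡hub = x∉W (subst W (sym x≡hub) hub∈W)
      hub∉W : ¬ W hub
      hub∉W hub∈W with least hub 1 hub∈W (edgeDist (x≢hub hub∈W) (toHub x (x≢hub hub∈W)))
      ... | s≤s ()

  resolved⇒edge : ∀ {W : V → Set} {x y} → x ≢ y → StronglyResolves (Wheel r) W x y →
                  (x ~ y ⊎ y ~ x) × ¬ W hub
  resolved⇒edge x≢y (x∉W , y∉W , inj₁ (_ , _ , _ , dxW , dxy , dyW , eq))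
    with forcedEdge x≢y x∉W y∉W dxW dxy dyW eq
  ... | x~y , hub∉W = inj₁ x~y , hub∉W
  resolved⇒edge x≢y (x∉W , y∉W , inj₂ (_ , _ , _ , dyW , dyx , dxW , eq))
    with forcedEdge (λ y≡x → x≢y (sym y≡x)) y∉W x∉W dyW dyx dxW eq
  ... | y~x , hub∉W = inj₂ y~x , hub∉W

  reachAtLeast1 : ∀ {W : V → Set} {x v} j → ¬ W x → W v → Walk (Wheel r) x v j → 1 ≤ j
  reachAtLeast1 zero    x∉W v∈W here = ⊥-elim (x∉W v∈W)
  reachAtLeast1 (suc _) _   _   _    = s≤s z≤n

  reachAtLeast2 : ∀ {W : V → Set} {x v} j → ¬ W x → (∀ u → W u → ¬ x ~ u) →
                  W v → Walk (Wheel r) x v j → 2 ≤ j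
  reachAtLeast2 zero          x∉W _         v∈W here            = ⊥-elim (x∉W v∈W)
  reachAtLeast2 (suc zero)    _   noNeighbour v∈W (step x~v here) = ⊥-elim (noNeighbour _ v∈W x~v)
  reachAtLeast2 (suc (suc _)) _   _         _   _               = s≤s (s≤s z≤n)

  resolvedBy : ∀ {W : V → Set} {x y w} → x ≢ y → ¬ W x → ¬ W y →
               (∀ u → W u → ¬ x ~ u) → x ~ y → W (rim w) → y ~ rim w →
               StronglyResolves (Wheel r) W x y
  resolvedBy {W} {x} {y} {w} x≢y x∉W y∉W noNeighbour x~y w∈W y~w =
    x∉W , y∉W , inj₁ (2 , 1 , 1 , dxW , edgeDist x≢y x~y , dyW , refl)
    where
      x≢hub : x ≢ hub
      x≢hub refl = noNeighbour (rim w) w∈W tt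
      dxW : DistSet (Wheel r) x W 2
      dxW = (rim w , w∈W , step {y = hub} (toHub x x≢hub) (step tt here) ,
              λ j walk → reachAtLeast2 j x∉W noNeighbour w∈W walk)
          , λ u j u∈W d → reachAtLeast2 j x∉W noNeighbour u∈W (proj₁ d)
      dyW : DistSet (Wheel r) y W 1
      dyW = (rim w , w∈W , edgeDist (λ y≡w → y∉W (subst W (sym y≡w) w∈W)) y~w)
          , λ u j u∈W d → reachAtLeast1 j y∉W u∈W (proj₁ d)

  resolves-sym : ∀ {W : V → Set} {x y} → StronglyResolves (Wheel r) W x y →
                 StronglyResolves (Wheel r) W y x
  resolves-sym (x∉W , y∉W , resolution) = y∉W , x∉W , swap resolution

-- CycSucc r i j unfolds to RimSucc r (toℕ i) (toℕ j); stating facts on the indices lets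
-- us match on the equations.
RimSucc : ℕ → ℕ → ℕ → Set
RimSucc r a b = (suc a ≡ b) ⊎ ((a ≡ r ∸ 1) × (b ≡ 0))

twoSteps : ∀ q {a b c} → RimSucc (4 + q) a b → RimSucc (4 + q) b c →
           a ≢ c × ¬ RimSucc (4 + q) a c × ¬ RimSucc (4 + q) c a
twoSteps q (inj₁ refl) (inj₁ refl) =
  (λ ()) , (λ { (inj₁ ()) ; (inj₂ (_ , ())) }) , (λ { (inj₁ ()) ; (inj₂ (() , refl)) })
twoSteps q (inj₁ refl) (inj₂ (refl , refl)) =
  (λ ()) , (λ { (inj₁ ()) ; (inj₂ (() , _)) }) , (λ { (inj₁ ()) ; (inj₂ (() , _)) })
twoSteps q (inj₂ (refl , refl)) (inj₁ refl) =
  (λ ()) , (λ { (inj₁ ()) ; (inj₂ (_ , ())) }) , (λ { (inj₁ ()) ; (inj₂ (() , _)) })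
twoSteps q (inj₂ (refl , refl)) (inj₂ (() , _))

prev : ∀ {m} → Fin (suc m) → Fin (suc m)
prev {m} zero    = fromℕ m
prev     (suc i) = inject₁ i

prev-succ : ∀ {m} (i : Fin (suc m)) → CycSucc (suc m) (prev i) i
prev-succ {m} zero    = inj₂ (toℕ-fromℕ m , refl)
prev-succ     (suc i) = inj₁ (cong suc (toℕ-inject₁ i))

prev-unique : ∀ {m} (a i : Fin (suc m)) → CycSucc (suc m) a i → prev i ≡ a
prev-unique     a zero    (inj₁ ())
prev-unique {m} a zero    (inj₂ (a≡m , _)) = toℕ-injective (trans (toℕ-fromℕ m) (sym a≡m))
prev-unique     a (suc i) (inj₁ a+1≡i+1) =
  toℕ-injective (trans (toℕ-inject₁ i) (sym (suc-injective a+1≡i+1)))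
prev-unique     a (suc i) (inj₂ (_ , ()))

-- Rim vertices whose indices differ by at least 2 are not adjacent, unless the cycle
-- closes up between them (i = 0 and j = m).
farApart : ∀ {m} (i j : Fin (suc m)) → 2 + toℕ i ≤ toℕ j →
           0 < toℕ i ⊎ suc (toℕ j) < suc m → ¬ CycAdj (suc m) i j
farApart i j gap _ (inj₁ (inj₁ i+1≡j)) = 1+n≰n (subst (2 + toℕ i ≤_) (sym i+1≡j) gap)
farApart i j gap _ (inj₁ (inj₂ (_ , j≡0))) = n≮0 (subst (2 + toℕ i ≤_) j≡0 gap)
farApart i j gap _ (inj₂ (inj₁ j+1≡i)) =
  1+n≰n (≤-trans (n≤1+n _) (≤-trans (n≤1+n _) (subst (λ t → 2 + t ≤ toℕ j) (sym j+1≡i) gap)))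
farApart i j _ (inj₁ 0<i) (inj₂ (inj₂ (_ , i≡0))) = n≮0 (subst (0 <_) i≡0 0<i)
farApart i j _ (inj₂ j+1<m+1) (inj₂ (inj₂ (j≡m , _))) =
  1+n≰n (subst (λ t → suc (suc t) ≤ _) j≡m j+1<m+1)

module StrongPartition (r k : ℕ) (f : Fin (suc r) → Fin k)
                       (srp : IsStrongResolvingPartition (Wheel r) k f) where
  open WheelGeometry r

  sameClass⇒edge : ∀ {x y} → x ≢ y → f x ≡ f y → x ~ y ⊎ y ~ x
  sameClass⇒edge x≢y fx≡fy = proj₁ (resolved⇒edge x≢y (proj₂ (proj₂ srp _ _ x≢y fx≡fy)))

  resolvingClass : ∀ {x y} → x ≢ y → f x ≡ f y → ∃ λ c → c ≢ f x × c ≢ f hub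
  resolvingClass x≢y fx≡fy with proj₂ srp _ _ x≢y fx≡fy
  ... | c , resolves@(x∉c , _) =
    c , (λ c≡fx → x∉c (sym c≡fx)) , (λ c≡fhub → proj₂ (resolved⇒edge x≢y resolves) (sym c≡fhub))

-- At least ⌈r/2⌉ classes are needed: each class holds at most two rim vertices, and
-- then consecutive ones.  Tagging rim vertex i with its class and with whether its
-- predecessor shares that class gives an injection of the rim into Fin k ⊎ Fin k.
module RimLowerBound (q k : ℕ) (f : Fin (5 + q) → Fin k)
                     (srp : IsStrongResolvingPartition (Wheel (4 + q)) k f) where
  open StrongPartition (4 + q) k f srp

  class : Fin (4 + q) → Fin k
  class i = f (rim i)

  sameClass⇒adjacent : ∀ {i j} → i ≢ j → class i ≡ class j → CycAdj (4 + q) i j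
  sameClass⇒adjacent {i} {j} i≢j eq with sameClass⇒edge (i≢j ∘ rim-injective) eq
  ... | inj₁ i~j = i~j
  ... | inj₂ j~i = swap j~i

  noThreeInARow : ∀ i j → CycSucc (4 + q) i j → class (prev i) ≢ class j
  noThreeInARow i j i→j eq with twoSteps q (prev-succ i) i→j
  ... | p≢j , ¬p→j , ¬j→p with sameClass⇒adjacent (λ p≡j → p≢j (cong toℕ p≡j)) eq
  ...   | inj₁ p→j = ¬p→j p→j
  ...   | inj₂ j→p = ¬j→p j→p

  tag : Fin (4 + q) → Fin k ⊎ Fin k
  tag i with class (prev i) ≟ᶠ class i
  ... | yes _ = inj₁ (class i)
  ... | no  _ = inj₂ (class i)

  -- Two different rim vertices of one class whose predecessors share their classes would
  -- put three consecutive vertices into that class.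
  bothExtended : ∀ {i j} → i ≢ j → class i ≡ class j →
                 class (prev i) ≡ class i → class (prev j) ≡ class j → ⊥
  bothExtended {i} {j} i≢j ci≡cj pi≡i pj≡j with sameClass⇒adjacent i≢j ci≡cj
  ... | inj₁ i→j = noThreeInARow i j i→j (trans pi≡i ci≡cj)
  ... | inj₂ j→i = noThreeInARow j i j→i (trans pj≡j (sym ci≡cj))

  -- Two different rim vertices of one class are consecutive, so one is the predecessor
  -- of the other and that one shares its class with its predecessor.
  neitherExtended : ∀ {i j} → i ≢ j → class i ≡ class j →
                    class (prev i) ≢ class i → class (prev j) ≢ class j → ⊥
  neitherExtended {i} {j} i≢j ci≡cj pi≢i pj≢j with sameClass⇒adjacent i≢j ci≡cj
  ... | inj₁ i→j = pj≢j (trans (cong class (prev-unique i j i→j)) ci≡cj)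
  ... | inj₂ j→i = pi≢i (trans (cong class (prev-unique j i j→i)) (sym ci≡cj))

  tag-injective : ∀ {i j} → tag i ≡ tag j → i ≡ j
  tag-injective {i} {j} eq with i ≟ᶠ j
  ... | yes i≡j = i≡j
  ... | no i≢j with class (prev i) ≟ᶠ class i | class (prev j) ≟ᶠ class j | eq
  ...   | yes pi≡i | yes pj≡j | same = ⊥-elim (bothExtended i≢j (inj₁-injective same) pi≡i pj≡j)
  ...   | no pi≢i  | no pj≢j  | same = ⊥-elim (neitherExtended i≢j (inj₂-injective same) pi≢i pj≢j)
  ...   | yes _    | no _     | ()
  ...   | no _     | yes _    | ()

  code : Fin (4 + q) → Fin (k + k)
  code i = join k k (tag i)

  code-injective : ∀ {i j} → code i ≡ code j → i ≡ j
  code-injective {i} {j} eq =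
    tag-injective (trans (sym (splitAt-join k k (tag i)))
                         (trans (cong (splitAt k) eq) (splitAt-join k k (tag j))))

  bound : ⌈ 4 + q /2⌉ ≤ k
  bound = halfBound (injective⇒≤ code-injective)
    where
      halfBound : 4 + q ≤ k + k → ⌈ 4 + q /2⌉ ≤ k
      halfBound h = subst (⌈ 4 + q /2⌉ ≤_) (sym (n≡⌈n+n/2⌉ k)) (⌈n/2⌉-mono h)

-- Two classes never suffice: by resolvingClass a pair in a common class needs a third
-- class besides its own and the hub's, so with two classes at most one vertex lies outside
-- the hub's class; but the non-adjacent pairs (0,2) and (1,3) each put one vertex there.
module NoTwoClasses (q : ℕ) (f : Fin (5 + q) → Fin 2)
                    (srp : IsStrongResolvingPartition (Wheel (4 + q)) 2 f) where
  open StrongPartition (4 + q) 2 f srp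

  bothDifferFrom : (a b h : Fin 2) → a ≢ h → b ≢ h → a ≡ b
  bothDifferFrom zero       zero       _          _   _   = refl
  bothDifferFrom (suc zero) (suc zero) _          _   _   = refl
  bothDifferFrom zero       (suc zero) zero       a≢h _   = ⊥-elim (a≢h refl)
  bothDifferFrom zero       (suc zero) (suc zero) _   b≢h = ⊥-elim (b≢h refl)
  bothDifferFrom (suc zero) zero       zero       _   b≢h = ⊥-elim (b≢h refl)
  bothDifferFrom (suc zero) zero       (suc zero) a≢h _   = ⊥-elim (a≢h refl)

  offHubUnique : ∀ {u v} → f u ≢ f hub → f v ≢ f hub → u ≡ v
  offHubUnique {u} {v} u∉hub v∉hub with u ≟ᶠ v
  ... | yes u≡v = u≡v
  ... | no  u≢v with resolvingClass u≢v (bothDifferFrom (f u) (f v) (f hub) u∉hub v∉hub)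
  ...   | c , c≢fu , c≢fhub =
    ⊥-elim (u∉hub (bothDifferFrom (f u) (f hub) c (c≢fu ∘ sym) (c≢fhub ∘ sym)))

  offHub : ∀ i j → i ≢ j → ¬ CycAdj (4 + q) i j →
           ∃ λ w → (w ≡ rim i ⊎ w ≡ rim j) × f w ≢ f hub
  offHub i j i≢j i≁j with f (rim i) ≟ᶠ f hub
  ... | no  i∉hub = rim i , inj₁ refl , i∉hub
  ... | yes i∈hub = rim j , inj₂ refl , λ j∈hub →
    [ i≁j , i≁j ∘ swap ] (sameClass⇒edge (i≢j ∘ rim-injective) (trans i∈hub (sym j∈hub)))

  impossible : ⊥
  impossible
    with offHub (# 0) (# 2) (λ ()) (farApart (# 0) (# 2) ≤-refl (inj₂ (s≤s (s≤s (s≤s (s≤s z≤n))))))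
       | offHub (# 1) (# 3) (λ ()) (farApart (# 1) (# 3) ≤-refl (inj₁ (s≤s z≤n)))
  ... | u , u∈02 , u∉hub | v , v∈13 , v∉hub = distinct u∈02 v∈13 (offHubUnique u∉hub v∉hub)
    where
      distinct : ∀ {u v} → (u ≡ rim (# 0) ⊎ u ≡ rim (# 2)) → (v ≡ rim (# 1) ⊎ v ≡ rim (# 3)) →
                 u ≢ v
      distinct (inj₁ refl) (inj₁ refl) ()
      distinct (inj₁ refl) (inj₂ refl) ()
      distinct (inj₂ refl) (inj₁ refl) ()
      distinct (inj₂ refl) (inj₂ refl) ()

module FourWheel where
  open WheelGeometry 4

  pattern v₀ = rim zero
  pattern v₁ = rim (suc zero)
  pattern v₂ = rim (suc (suc zero))
  pattern v₃ = rim (suc (suc (suc zero)))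

  part : Fin 5 → Fin 3
  part hub = # 0
  part v₀  = # 0
  part v₁  = # 0
  part v₂  = # 1
  part v₃  = # 2

  surjective : IsPartition (Wheel 4) 3 part
  surjective zero             = hub , refl
  surjective (suc zero)       = v₂ , refl
  surjective (suc (suc zero)) = v₃ , refl

  Resolved : Fin 3 → Fin 5 → Fin 5 → Set
  Resolved c x y = StronglyResolves (Wheel 4) (Class (Wheel 4) part c) x y

  v₀-far : ∀ u → part u ≡ # 1 → ¬ v₀ ~ u
  v₀-far hub ()
  v₀-far v₀  ()
  v₀-far v₁  ()
  v₀-far v₂  refl = farApart (# 0) (# 2) ≤-refl (inj₂ (s≤s (s≤s (s≤s (s≤s z≤n)))))
  v₀-far v₃  ()

  v₁-far : ∀ u → part u ≡ # 2 → ¬ v₁ ~ u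
  v₁-far hub ()
  v₁-far v₀  ()
  v₁-far v₁  ()
  v₁-far v₂  ()
  v₁-far v₃  refl = farApart (# 1) (# 3) ≤-refl (inj₁ (s≤s z≤n))

  hub-v₀ : Resolved (# 1) v₀ hub
  hub-v₀ = resolvedBy {w = # 2} (λ ()) (λ ()) (λ ()) v₀-far tt refl tt

  hub-v₁ : Resolved (# 2) v₁ hub
  hub-v₁ = resolvedBy {w = # 3} (λ ()) (λ ()) (λ ()) v₁-far tt refl tt

  v₀-v₁ : Resolved (# 1) v₀ v₁
  v₀-v₁ = resolvedBy {w = # 2} (λ ()) (λ ()) (λ ()) v₀-far
                     (inj₁ (inj₁ refl)) refl (inj₁ (inj₁ refl))

  resolve : ∀ x y → x ≢ y → part x ≡ part y → ∃ λ c → Resolved c x y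
  resolve hub hub x≢y _ = ⊥-elim (x≢y refl)
  resolve hub v₀  _   _ = _ , resolves-sym hub-v₀
  resolve hub v₁  _   _ = _ , resolves-sym hub-v₁
  resolve hub v₂  _   ()
  resolve hub v₃  _   ()
  resolve v₀  hub _   _ = _ , hub-v₀
  resolve v₀  v₀  x≢y _ = ⊥-elim (x≢y refl)
  resolve v₀  v₁  _   _ = _ , v₀-v₁
  resolve v₀  v₂  _   ()
  resolve v₀  v₃  _   ()
  resolve v₁  hub _   _ = _ , hub-v₁
  resolve v₁  v₀  _   _ = _ , resolves-sym v₀-v₁
  resolve v₁  v₁  x≢y _ = ⊥-elim (x≢y refl)
  resolve v₁  v₂  _   ()
  resolve v₁  v₃  _   ()
  resolve v₂  hub _   ()
  resolve v₂  v₀  _   ()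
  resolve v₂  v₁  _   ()
  resolve v₂  v₂  x≢y _ = ⊥-elim (x≢y refl)
  resolve v₂  v₃  _   ()
  resolve v₃  hub _   ()
  resolve v₃  v₀  _   ()
  resolve v₃  v₁  _   ()
  resolve v₃  v₂  _   ()
  resolve v₃  v₃  x≢y _ = ⊥-elim (x≢y refl)

  lowerBound : ∀ k (f : Fin 5 → Fin k) → IsStrongResolvingPartition (Wheel 4) k f → 3 ≤ k
  lowerBound k f srp with RimLowerBound.bound 0 k f srp
  lowerBound zero                _ _   | ()
  lowerBound (suc zero)          _ _   | s≤s ()
  lowerBound (suc (suc zero))    f srp | _ = ⊥-elim (NoTwoClasses.impossible 0 f srp)
  lowerBound (suc (suc (suc _))) _ _   | _ = s≤s (s≤s (s≤s z≤n))

  pds : PDs (Wheel 4) 3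
  pds = (part , surjective , resolve) , lowerBound

parity : ∀ t → t ≡ ⌊ t /2⌋ + ⌊ t /2⌋ ⊎ t ≡ suc (⌊ t /2⌋ + ⌊ t /2⌋)
parity zero       = inj₁ refl
parity (suc zero) = inj₂ refl
parity (suc (suc t)) with parity t
... | inj₁ t≡2c   = inj₁ (trans (cong (2 +_) t≡2c) (sym (cong suc (+-suc ⌊ t /2⌋ ⌊ t /2⌋))))
... | inj₂ t≡2c+1 = inj₂ (trans (cong (2 +_) t≡2c+1) (sym (cong (2 +_) (+-suc ⌊ t /2⌋ ⌊ t /2⌋))))

halfBounds : ∀ t → ⌊ t /2⌋ + ⌊ t /2⌋ ≤ t × t ≤ suc (⌊ t /2⌋ + ⌊ t /2⌋)
halfBounds t with parity t
... | inj₁ t≡2c   = ≤-reflexive (sym t≡2c) , ≤-trans (≤-reflexive t≡2c) (n≤1+n _)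
... | inj₂ t≡2c+1 = ≤-trans (n≤1+n _) (≤-reflexive (sym t≡2c+1)) , ≤-reflexive t≡2c+1

halfZero : ∀ t → ⌊ t /2⌋ ≡ 0 → t ≡ 0 ⊎ t ≡ 1
halfZero zero          _  = inj₁ refl
halfZero (suc zero)    _  = inj₂ refl
halfZero (suc (suc _)) ()

Consecutive : ℕ → ℕ → ℕ → Set
Consecutive m s t = s ≡ m + m × t ≡ suc (m + m)

double : ℕ → ℕ
double n = n + n

sameHalf : ∀ s t → s ≢ t → ⌊ s /2⌋ ≡ ⌊ t /2⌋ → ∃ λ m → Consecutive m s t ⊎ Consecutive m t s
sameHalf s t s≢t eq with parity s | parity t
... | inj₁ s≡2c   | inj₁ t≡2c   = ⊥-elim (s≢t (trans s≡2c (trans (cong double eq) (sym t≡2c))))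
... | inj₂ s≡2c+1 | inj₂ t≡2c+1 =
  ⊥-elim (s≢t (trans s≡2c+1 (trans (cong ((1 +_) ∘ double) eq) (sym t≡2c+1))))
... | inj₁ s≡2c   | inj₂ t≡2c+1 =
  ⌊ s /2⌋ , inj₁ (s≡2c , trans t≡2c+1 (cong ((1 +_) ∘ double) (sym eq)))
... | inj₂ s≡2c+1 | inj₁ t≡2c   = ⌊ s /2⌋ , inj₂ (trans t≡2c (cong double (sym eq)) , s≡2c+1)

module BlockPartition (p : ℕ) where
  open WheelGeometry (5 + p)

  K : ℕ
  K = ⌈ 5 + p /2⌉

  block : V → ℕ
  block hub     = 0
  block (rim i) = ⌊ toℕ i /2⌋

  block<K : ∀ v → block v < K
  block<K hub     = s≤s z≤n
  block<K (rim i) = ⌈n/2⌉-mono (toℕ<n i)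

  part : V → Fin K
  part v = fromℕ< (block<K v)

  part⇒block : ∀ x y → part x ≡ part y → block x ≡ block y
  part⇒block x y eq =
    trans (sym (toℕ-fromℕ< (block<K x))) (trans (cong toℕ eq) (toℕ-fromℕ< (block<K y)))

  -- Every block c < K contains the rim vertex 2c.
  double<r : ∀ {c} → c < K → c + c < 5 + p
  double<r {c} c<K = ≰⇒> λ r≤2c →
    1+n≰n (≤-trans c<K (subst (K ≤_) (sym (n≡⌈n+n/2⌉ c)) (⌈n/2⌉-mono r≤2c)))

  surjective : IsPartition (Wheel (5 + p)) K part
  surjective c = rim (fromℕ< (double<r (toℕ<n c))) , toℕ-injective (begin
    toℕ (part (rim (fromℕ< (double<r (toℕ<n c)))))  ≡⟨ toℕ-fromℕ< _ ⟩
    ⌊ toℕ (fromℕ< (double<r (toℕ<n c))) /2⌋       ≡⟨ cong ⌊_/2⌋ (toℕ-fromℕ< _) ⟩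
    ⌊ toℕ c + toℕ c /2⌋                            ≡⟨ sym (n≡⌊n+n/2⌋ (toℕ c)) ⟩
    toℕ c                                          ∎)
    where open ≡-Reasoning

  Resolved : Fin K → V → V → Set
  Resolved c x y = StronglyResolves (Wheel (5 + p)) (Class (Wheel (5 + p)) part c) x y

  NoNeighbourIn : V → ℕ → Set
  NoNeighbourIn x c = ∀ v → block v ≡ c → ¬ x ~ v

  resolveVia : ∀ {x y} (w : Fin (5 + p)) → x ≢ y → block x ≡ block y → block x ≢ block (rim w) →
               x ~ y → y ~ rim w → NoNeighbourIn x (block (rim w)) →
               ∃ λ c → Resolved c x y × Resolved c y x
  resolveVia {x} {y} w x≢y bx≡by bx≢bw x~y y~w noNeighbour =
    part (rim w) , resolved , resolves-sym resolved
    where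
      resolved : Resolved (part (rim w)) x y
      resolved = resolvedBy x≢y (bx≢bw ∘ part⇒block x (rim w))
                   (λ y∈W → bx≢bw (trans bx≡by (part⇒block y (rim w) y∈W)))
                   (λ u u∈W → noNeighbour u (part⇒block u (rim w) u∈W)) x~y refl y~w

  belowBlock : ∀ i c → 2 + toℕ i ≤ c + c → 0 < toℕ i ⊎ 2 + (c + c) < 5 + p →
               NoNeighbourIn (rim i) c
  belowBlock i _ gap _    hub     refl = λ _ → n≮0 gap
  belowBlock i _ gap side (rim j) refl =
    farApart i j (≤-trans gap lower) (⊎-map₂ (≤-trans (s≤s (s≤s upper))) side)
    where open Σ (halfBounds (toℕ j)) renaming (proj₁ to lower; proj₂ to upper)

  aboveBlock : ∀ i c → 0 < c → 3 + (c + c) ≤ toℕ i → NoNeighbourIn (rim i) c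
  aboveBlock i _ () _   hub     refl
  aboveBlock i c 0<c gap (rim j) refl =
    farApart j i (≤-trans (s≤s (s≤s upper)) gap)
                 (inj₁ (≤-trans 0<c (≤-trans (m≤m+n c c) lower))) ∘ swap
    where open Σ (halfBounds (toℕ j)) renaming (proj₁ to lower; proj₂ to upper)

  module _ {e o : Fin (5 + p)} (m : ℕ) (e≡2m : toℕ e ≡ m + m) (o≡2m+1 : toℕ o ≡ suc (m + m)) where

    evenBlock : block (rim e) ≡ m
    evenBlock = trans (cong ⌊_/2⌋ e≡2m) (sym (n≡⌊n+n/2⌋ m))

    oddBlock : block (rim o) ≡ m
    oddBlock = trans (cong ⌊_/2⌋ o≡2m+1) (sym (n≡⌈n+n/2⌉ m))

    sameBlock : block (rim e) ≡ block (rim o)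
    sameBlock = trans evenBlock (sym oddBlock)

    e≢o : rim e ≢ rim o
    e≢o e≡o = 1+n≢n (trans (sym o≡2m+1) (trans (cong toℕ (sym (rim-injective e≡o))) e≡2m))

    e→o : CycSucc (5 + p) e o
    e→o = inj₁ (trans (cong suc e≡2m) (sym o≡2m+1))

    forward : ∀ w → toℕ w ≡ 2 + (m + m) → NoNeighbourIn (rim e) (suc m) →
              ∃ λ c → Resolved c (rim e) (rim o) × Resolved c (rim o) (rim e)
    forward w w≡2m+2 noNeighbour =
      resolveVia w e≢o sameBlock (λ eq → 1+n≢n (trans (sym wBlock) (trans (sym eq) evenBlock)))
        (inj₁ e→o) (inj₁ (inj₁ (trans (cong suc o≡2m+1) (sym w≡2m+2))))
        (subst (NoNeighbourIn (rim e)) (sym wBlock) noNeighbour)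
      where
        wBlock : block (rim w) ≡ suc m
        wBlock = trans (cong ⌊_/2⌋ w≡2m+2) (cong suc (sym (n≡⌊n+n/2⌋ m)))

    backward : ∀ w → suc (toℕ w) ≡ toℕ e → block (rim w) ≢ m →
               NoNeighbourIn (rim o) (block (rim w)) →
               ∃ λ c → Resolved c (rim e) (rim o) × Resolved c (rim o) (rim e)
    backward w w+1≡e wBlock≢m noNeighbour =
      map₂ swapPair (resolveVia w (e≢o ∘ sym) (sym sameBlock)
        (λ eq → wBlock≢m (trans (sym eq) oddBlock)) (inj₂ e→o) (inj₂ (inj₁ w+1≡e)) noNeighbour)
      where
        swapPair : ∀ {c} → Resolved c (rim o) (rim e) × Resolved c (rim e) (rim o) →
                   Resolved c (rim e) (rim o) × Resolved c (rim o) (rim e)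
        swapPair (r₁ , r₂) = r₂ , r₁

  -- For m = c + 1 ≥ 2 the vertex w = 2c + 1 precedes 2m and lies in block c ≥ 1, where
  -- 2m + 1 has no neighbour.
  backwardPair : ∀ {e o} c → 0 < c → Consecutive (suc c) (toℕ e) (toℕ o) →
                 ∃ λ b → Resolved b (rim e) (rim o) × Resolved b (rim o) (rim e)
  backwardPair {e} {o} c 0<c (e≡2m , o≡2m+1) =
    backward (suc c) e≡2m o≡2m+1 w (trans (cong suc w≡2c+1) (sym e≡2c+2))
      (λ eq → 1+n≢n (trans (sym eq) wBlock))
      (subst (NoNeighbourIn (rim o)) (sym wBlock)
        (aboveBlock o c 0<c (≤-reflexive (sym (trans o≡2m+1 (cong (2 +_) (+-suc c c)))))))
    where
      e≡2c+2 : toℕ e ≡ 2 + (c + c)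
      e≡2c+2 = trans e≡2m (cong suc (+-suc c c))
      w<r : suc (c + c) < 5 + p
      w<r = ≤-trans (n≤1+n _) (subst (_< 5 + p) e≡2c+2 (toℕ<n e))
      w : Fin (5 + p)
      w = fromℕ< w<r
      w≡2c+1 : toℕ w ≡ suc (c + c)
      w≡2c+1 = toℕ-fromℕ< w<r
      wBlock : block (rim w) ≡ c
      wBlock = trans (cong ⌊_/2⌋ w≡2c+1) (sym (n≡⌈n+n/2⌉ c))

  zeroFar : ∀ {i} → toℕ i ≡ 0 → NoNeighbourIn (rim i) 1
  zeroFar {i} i≡0 =
    belowBlock i 1 (≤-reflexive (cong (2 +_) i≡0)) (inj₂ (s≤s (s≤s (s≤s (s≤s (s≤s z≤n))))))

  lowFar : ∀ {i} → 0 < toℕ i → toℕ i ≤ 2 → NoNeighbourIn (rim i) 2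
  lowFar {i} 0<i i≤2 = belowBlock i 2 (s≤s (s≤s i≤2)) (inj₁ 0<i)

  hubPair : ∀ j → block (rim j) ≡ 0 → ∃ λ c → Resolved c (rim j) hub × Resolved c hub (rim j)
  hubPair j j∈0 with halfZero (toℕ j) j∈0
  ... | inj₁ j≡0 = resolveVia (# 2) (λ ()) j∈0 (0≢1+n ∘ trans (sym j∈0)) tt tt (zeroFar j≡0)
  ... | inj₂ j≡1 = resolveVia (# 4) (λ ()) j∈0 (0≢1+n ∘ trans (sym j∈0)) tt tt
                     (lowFar (subst (0 <_) (sym j≡1) (s≤s z≤n))
                             (≤-trans (≤-reflexive j≡1) (n≤1+n 1)))

  rimPair : ∀ {e o} m → Consecutive m (toℕ e) (toℕ o) →
            ∃ λ c → Resolved c (rim e) (rim o) × Resolved c (rim o) (rim e)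
  rimPair zero          (e≡0 , o≡1)     = forward 0 e≡0 o≡1 (# 2) refl (zeroFar e≡0)
  rimPair (suc zero)    (e≡2 , o≡3)     =
    forward 1 e≡2 o≡3 (# 4) refl (lowFar (subst (0 <_) (sym e≡2) (s≤s z≤n)) (≤-reflexive e≡2))
  rimPair (suc (suc c)) consecutive     = backwardPair (suc c) (s≤s z≤n) consecutive

  resolve : ∀ x y → x ≢ y → part x ≡ part y → ∃ λ c → Resolved c x y
  resolve hub     hub     x≢y _  = ⊥-elim (x≢y refl)
  resolve hub     (rim j) _   eq = map₂ proj₂ (hubPair j (sym (part⇒block hub (rim j) eq)))
  resolve (rim i) hub     _   eq = map₂ proj₁ (hubPair i (part⇒block (rim i) hub eq))
  resolve (rim i) (rim j) i≢j eq
    with sameHalf (toℕ i) (toℕ j) (i≢j ∘ cong rim ∘ toℕ-injective) (part⇒block (rim i) (rim j) eq)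
  ... | m , inj₁ i,j = map₂ proj₁ (rimPair m i,j)
  ... | m , inj₂ j,i = map₂ proj₂ (rimPair m j,i)

  pds : PDs (Wheel (5 + p)) K
  pds = (part , surjective , resolve) , λ k f srp → RimLowerBound.bound (suc p) k f srp

mainTheorem17 : (r : ℕ) → 4 ≤ r →
    (r ≡ 4 → PDs (Wheel r) 3) × (5 ≤ r → PDs (Wheel r) ⌈ r /2⌉)
mainTheorem17 (suc zero)                      (s≤s ())
mainTheorem17 (suc (suc zero))                (s≤s (s≤s ()))
mainTheorem17 (suc (suc (suc zero)))          (s≤s (s≤s (s≤s ())))
mainTheorem17 (suc (suc (suc (suc zero))))    _ =
  (λ _ → FourWheel.pds) , λ { (s≤s (s≤s (s≤s (s≤s ())))) }
mainTheorem17 (suc (suc (suc (suc (suc p))))) _ = (λ ()) , λ _ → BlockPartition.pds p
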